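{- For every integer $n\ge 6$, the Hadwiger number of the complement $\overline{W_n}$ of the wheel graph $W_n$ equals $\lfloor 3(n-1)/4\rfloor$.
   Context: For $n\ge 4$, the wheel graph $W_n$ on $n$ vertices is the join $K_1+C_{n-1}$: a cycle on $n-1$ vertices together with one additional vertex adjacent to all vertices of the cycle. The complement $\overline{G}$ has the same vertex set as $G$, with two distinct vertices adjacent iff they are not adjacent in $G$. The Hadwiger number of a graph is the largest $k$ such that $K_k$ is a minor of the graph (minors obtained by vertex deletions, edge deletions and edge contractions). -}

module Defs where

open import Data.Nat using (ℕ; zero; suc; _∸_; _≤_)
open import Data.Fin using (Fin; zero; suc; toℕ)
open import Data.Maybe using (Maybe; just)
open import Data.Product using (Σ; ∃; _×_; _,_)
open import Data.Sum using (_⊎_)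
open import Data.Empty using (⊥)
open import Data.Unit using (⊤)
open import Relation.Nullary using (¬_)
open import Relation.Binary.PropositionalEquality using (_≡_; _≢_)

Graph : ℕ → Set₁
Graph n = Fin n → Fin n → Set

-- Cycle C_m on vertex set Fin m: i ~ j iff j = i+1 or i = j+1 (mod m).
-- (For m ≥ 3 this is the usual cycle graph.)
CycleAdj : (m : ℕ) → Fin m → Fin m → Set
CycleAdj m i j =
  (toℕ j ≡ suc (toℕ i)) ⊎ (toℕ i ≡ suc (toℕ j)) ⊎
  ((toℕ i ≡ 0 × toℕ j ≡ m ∸ 1) ⊎ (toℕ j ≡ 0 × toℕ i ≡ m ∸ 1))

-- Wheel W_n = K_1 + C_{n-1}: vertex zero is the hub, vertices suc i (i : Fin (n-1)) form the cycle.
Wheel : (n : ℕ) → Graph n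
Wheel zero ()
Wheel (suc m) zero    zero    = ⊥
Wheel (suc m) zero    (suc j) = ⊤
Wheel (suc m) (suc i) zero    = ⊤
Wheel (suc m) (suc i) (suc j) = CycleAdj m i j

Complement : {n : ℕ} → Graph n → Graph n
Complement G i j = (i ≢ j) × ¬ G i j

data PathIn {n : ℕ} (G : Graph n) (P : Fin n → Set) : Fin n → Fin n → Set where
  here : ∀ {u} → P u → PathIn G P u u
  step : ∀ {u v w} → P u → G u v → PathIn G P v w → PathIn G P u w

-- Disjointness is built in: each vertex is assigned to at most one branch set
-- (branch v ≡ just a means v ∈ V_a).
record KMinor {n : ℕ} (G : Graph n) (k : ℕ) : Set where
  field
    branch    : Fin n → Maybe (Fin k)
    nonempty  : ∀ a → ∃ λ v → branch v ≡ just a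
    connected : ∀ a u v → branch u ≡ just a → branch v ≡ just a →
                PathIn G (λ w → branch w ≡ just a) u v
    touching  : ∀ a b → a ≢ b →
                Σ (Fin n) λ u → Σ (Fin n) λ v →
                  branch u ≡ just a × branch v ≡ just b × G u v

HasCompleteMinor : {n : ℕ} → Graph n → ℕ → Set
HasCompleteMinor G k = KMinor G k

IsHadwigerNumber : {n : ℕ} → Graph n → ℕ → Set
IsHadwigerNumber G h = HasCompleteMinor G h × (∀ k → HasCompleteMinor G k → k ≤ h)

{-# OPTIONS --safe #-}
module Submission where

-- The hub of W_n is adjacent to every other vertex, so in the complement it is isolated, and
-- what remains is the complement of the rim C_m with m = n − 1.
--
-- Lower bound: in the complement of C_m take the odd vertices 1, 3, …, 2s₁ − 1 as singleton
-- branch sets and the pairs {2j, 2j + 2s₂} (j < s₂) of even vertices. Two odd vertices are never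
-- consecutive, two even vertices only via the wrap-around edge {0, m − 1}, which the pairs avoid,
-- and an odd vertex is consecutive to at most one vertex of a pair. With s₁ = ⌊m/2⌋ and s₂ = ⌊(m+1)/4⌋ this gives ⌊3m/4⌋ branch sets as
-- soon as s₂ ≥ 2, i.e. m ≥ 7; for m = 5, 6 a small model is checked by decision.
--
-- Upper bound: if k ≥ 2 the hub lies in no branch set. Hand out to each branch set four of the
-- 3m tokens (v, 0), (v, 1), (v, 2): a branch set with distinct vertices u, v gets (u,0), (u,1),
-- (v,0), (v,1); a singleton {u} gets (u,0), (u,1), (u,2), (u+1,2). No token is handed out twice,
-- because two singleton branch sets are adjacent in the complement, so not consecutive on the
-- rim. Hence 4k ≤ 3m.

open import Defs
open import Data.Nat as ℕ using (ℕ; zero; suc; _+_; _*_; _∸_; _/_; _≤_; _<_; z≤n; s≤s)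
open import Data.Nat.Properties
open import Data.Nat.DivMod using (+-distrib-/-∣ˡ; m/n*n≤m; m*n/n≡m; /-monoˡ-≤)
open import Data.Nat.Divisibility using (divides-refl)
open import Data.Fin as Fin using (Fin; zero; suc; toℕ; fromℕ; inject₁; #_)
open import Data.Fin.Properties
  using (all?; any?; toℕ-injective; toℕ<n; toℕ-fromℕ<; toℕ-lower₁; join-splitAt; combine-injective;
         combine-remQuot; injective⇒≤; inject₁-injective; fromℕ≢inject₁)
  renaming (_≟_ to _≟ᶠ_)
import Data.Fin.Properties as Finₚ
open import Data.Vec using (Vec; []; _∷_; lookup)
open import Data.Maybe using (Maybe; just; nothing)
open import Data.Maybe.Properties using (just-injective) renaming (≡-dec to ≡-decᵐ)
open import Data.Product using (∃; ∃₂; _×_; _,_; proj₁; proj₂; uncurry)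
open import Data.Product.Properties using (,-injective)
open import Data.Sum using (_⊎_; inj₁; inj₂)
open import Data.Empty using (⊥; ⊥-elim)
open import Function using (_∘_)
open import Relation.Nullary using (¬_; Dec; yes; no)
open import Relation.Nullary.Decidable using (_×-dec_; _⊎-dec_; _→-dec_; ¬?; True; toWitness)
open import Relation.Binary.PropositionalEquality

remQuot-injective : ∀ {n} k {x y : Fin (n * k)} → Fin.remQuot {n} k x ≡ Fin.remQuot k y → x ≡ y
remQuot-injective {n} k {x} {y} eq = begin
  x                                         ≡⟨ combine-remQuot {n} k x ⟨
  uncurry Fin.combine (Fin.remQuot {n} k x) ≡⟨ cong (uncurry Fin.combine) eq ⟩
  uncurry Fin.combine (Fin.remQuot {n} k y) ≡⟨ combine-remQuot {n} k y ⟩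
  y                                         ∎
  where open ≡-Reasoning

×-injective⇒≤ : ∀ {a b c d} (f : Fin a × Fin b → Fin c × Fin d) →
                (∀ {x y} → f x ≡ f y → x ≡ y) → a * b ≤ c * d
×-injective⇒≤ {a} {b} f f-injective = injective⇒≤ {f = uncurry Fin.combine ∘ f ∘ Fin.remQuot {a} b}
  λ eq → remQuot-injective {a} b (f-injective
    (let (p , q) = combine-injective _ _ _ _ eq in cong₂ _,_ p q))

splitAt-injective : ∀ m n {x y : Fin (m + n)} → Fin.splitAt m x ≡ Fin.splitAt m y → x ≡ y
splitAt-injective m n {x} {y} eq = begin
  x                              ≡⟨ join-splitAt m n x ⟨
  Fin.join m n (Fin.splitAt m x) ≡⟨ cong (Fin.join m n) eq ⟩
  Fin.join m n (Fin.splitAt m y) ≡⟨ join-splitAt m n y ⟩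
  y                              ∎
  where open ≡-Reasoning

m*n≤o⇒m≤o/n : ∀ m n o .{{_ : ℕ.NonZero n}} → m * n ≤ o → m ≤ o / n
m*n≤o⇒m≤o/n m n o le = subst (_≤ o / n) (m*n/n≡m m n) (/-monoˡ-≤ n le)

-- CycleAdj m i j unfolds to CycleAdjℕ m (toℕ i) (toℕ j).
CycleAdjℕ : ℕ → ℕ → ℕ → Set
CycleAdjℕ m x y =
  (y ≡ suc x) ⊎ (x ≡ suc y) ⊎ ((x ≡ 0 × y ≡ m ∸ 1) ⊎ (y ≡ 0 × x ≡ m ∸ 1))

cycleAdjℕ? : ∀ m x y → Dec (CycleAdjℕ m x y)
cycleAdjℕ? m x y =
  (y ≟ suc x) ⊎-dec (x ≟ suc y) ⊎-dec ((x ≟ 0 ×-dec y ≟ m ∸ 1) ⊎-dec (y ≟ 0 ×-dec x ≟ m ∸ 1))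

cycleAdjℕ-sym : ∀ {m x y} → CycleAdjℕ m x y → CycleAdjℕ m y x
cycleAdjℕ-sym (inj₁ e)               = inj₂ (inj₁ e)
cycleAdjℕ-sym (inj₂ (inj₁ e))        = inj₁ e
cycleAdjℕ-sym (inj₂ (inj₂ (inj₁ e))) = inj₂ (inj₂ (inj₂ e))
cycleAdjℕ-sym (inj₂ (inj₂ (inj₂ e))) = inj₂ (inj₂ (inj₁ e))

cycleAdjℕ-irrefl : ∀ {m x} → 2 ≤ m → ¬ CycleAdjℕ m x x
cycleAdjℕ-irrefl _ (inj₁ eq)        = 1+n≢n (sym eq)
cycleAdjℕ-irrefl _ (inj₂ (inj₁ eq)) = 1+n≢n (sym eq)
cycleAdjℕ-irrefl {suc (suc m)} _ (inj₂ (inj₂ (inj₁ (refl , ()))))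
cycleAdjℕ-irrefl {suc (suc m)} _ (inj₂ (inj₂ (inj₂ (refl , ()))))
cycleAdjℕ-irrefl {suc zero} (s≤s ()) (inj₂ (inj₂ _))

2*n≡n+n : ∀ n → 2 * n ≡ n + n
2*n≡n+n n = cong (n +_) (+-identityʳ n)

double≡0 : ∀ {i} → 2 * i ≡ 0 → i ≡ 0
double≡0 {zero} _ = refl

double-injective : ∀ {i j} → 2 * i ≡ 2 * j → i ≡ j
double-injective {i} {j} = *-cancelˡ-≡ i j 2

odd-odd-¬adj : ∀ m a b → ¬ CycleAdjℕ m (suc (2 * a)) (suc (2 * b))
odd-odd-¬adj m a b (inj₁ eq)        = even≢odd b a (suc-injective eq)
odd-odd-¬adj m a b (inj₂ (inj₁ eq)) = even≢odd a b (suc-injective eq)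
odd-odd-¬adj m a b (inj₂ (inj₂ (inj₁ (() , _))))
odd-odd-¬adj m a b (inj₂ (inj₂ (inj₂ (() , _))))

even-adj⇒wrap : ∀ m i j → CycleAdjℕ m (2 * i) (2 * j) →
                (i ≡ 0 × 2 * j ≡ m ∸ 1) ⊎ (j ≡ 0 × 2 * i ≡ m ∸ 1)
even-adj⇒wrap m i j (inj₁ eq)                     = ⊥-elim (even≢odd j i eq)
even-adj⇒wrap m i j (inj₂ (inj₁ eq))              = ⊥-elim (even≢odd i j eq)
even-adj⇒wrap m i j (inj₂ (inj₂ (inj₁ (i0 , e)))) = inj₁ (double≡0 i0 , e)
even-adj⇒wrap m i j (inj₂ (inj₂ (inj₂ (j0 , e)))) = inj₂ (double≡0 j0 , e)

odd-even-adj : ∀ m a j → CycleAdjℕ m (suc (2 * a)) (2 * j) →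
               (a ≤ j × j ≤ suc a) ⊎ (j ≡ 0 × suc (2 * a) ≡ m ∸ 1)
odd-even-adj m a j (inj₁ eq)
  rewrite double-injective {j} {suc a} (trans eq (sym (*-suc 2 a))) = inj₁ (n≤1+n a , ≤-refl)
odd-even-adj m a j (inj₂ (inj₁ eq))
  rewrite double-injective {a} {j} (suc-injective eq) = inj₁ (≤-refl , n≤1+n j)
odd-even-adj m a j (inj₂ (inj₂ (inj₁ (() , _))))
odd-even-adj m a j (inj₂ (inj₂ (inj₂ (j0 , e)))) = inj₂ (double≡0 j0 , e)

CoCycle : (m : ℕ) → Graph m
CoCycle m = Complement (CycleAdj m)

coCycle? : ∀ m (i j : Fin m) → Dec (CoCycle m i j)
coCycle? m i j = ¬? (i ≟ᶠ j) ×-dec ¬? (cycleAdjℕ? m (toℕ i) (toℕ j))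

coCycle-sym : ∀ {m} {i j : Fin m} → CoCycle m i j → CoCycle m j i
coCycle-sym {m} (i≢j , ¬adj) = (λ j≡i → i≢j (sym j≡i)) , (λ adj → ¬adj (cycleAdjℕ-sym {m} adj))

CoWheel : (n : ℕ) → Graph n
CoWheel n = Complement (Wheel n)

hub-isolated : ∀ {m} (v : Fin (suc m)) → ¬ CoWheel (suc m) zero v
hub-isolated zero    (hub≢hub , _) = hub≢hub refl
hub-isolated (suc _) (_ , ¬adj)    = ¬adj _

path-from-hub : ∀ {m} {P : Fin (suc m) → Set} {v} → PathIn (CoWheel (suc m)) P zero v → v ≡ zero
path-from-hub (here _)        = refl
path-from-hub (step _ edge _) = ⊥-elim (hub-isolated _ edge)

coWheel-minor : ∀ {m k} → KMinor (CoCycle m) k → KMinor (CoWheel (suc m)) k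
coWheel-minor {m} {k} M = record
  { branch    = branch′
  ; nonempty  = λ a → suc (proj₁ (nonempty a)) , proj₂ (nonempty a)
  ; connected = connected′
  ; touching  = λ a b a≢b → let (u , v , u∈a , v∈b , edge) = touching a b a≢b in
                  suc u , suc v , u∈a , v∈b , rim-edge edge
  }
  where
  open KMinor M
  branch′ : Fin (suc m) → Maybe (Fin k)
  branch′ zero    = nothing
  branch′ (suc v) = branch v

  rim-edge : ∀ {u v} → CoCycle m u v → CoWheel (suc m) (suc u) (suc v)
  rim-edge (u≢v , ¬adj) = (λ eq → u≢v (Finₚ.suc-injective eq)) , ¬adj

  rim-path : ∀ {a u v} → PathIn (CoCycle m) (λ w → branch w ≡ just a) u v →
             PathIn (CoWheel (suc m)) (λ w → branch′ w ≡ just a) (suc u) (suc v)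
  rim-path (here u∈a)           = here u∈a
  rim-path (step u∈a edge path) = step u∈a (rim-edge edge) (rim-path path)

  connected′ : ∀ a u v → branch′ u ≡ just a → branch′ v ≡ just a →
               PathIn (CoWheel (suc m)) (λ w → branch′ w ≡ just a) u v
  connected′ a (suc u) (suc v) u∈a v∈a = rim-path (connected a u v u∈a v∈a)

record PairModel {n : ℕ} (G : Graph n) (k : ℕ) : Set where
  field
    vertex   : Fin 2 → Fin k → Fin n
    disjoint : ∀ e f a b → vertex e a ≡ vertex f b → a ≡ b
    clique   : ∀ a e f → vertex e a ≡ vertex f a ⊎ G (vertex e a) (vertex f a)
    touching : ∀ a b → a ≢ b → ∃₂ λ e f → G (vertex e a) (vertex f b)

module _ {n k : ℕ} {G : Graph n} (P : PairModel G k) where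
  open PairModel P

  private
    Member : Fin k → Fin n → Set
    Member a v = ∃ λ e → vertex e a ≡ v

    member? : ∀ v → Dec (∃ λ a → Member a v)
    member? v = any? λ a → any? λ e → vertex e a ≟ᶠ v

    branch : Fin n → Maybe (Fin k)
    branch v with member? v
    ... | yes (a , _) = just a
    ... | no _        = nothing

    member⇒branch : ∀ {a v} → Member a v → branch v ≡ just a
    member⇒branch {a} {v} (e , eq) with member? v
    ... | yes (b , f , eq′) = cong just (disjoint f e b a (trans eq′ (sym eq)))
    ... | no ¬member        = ⊥-elim (¬member (a , e , eq))

    branch⇒member : ∀ {a v} → branch v ≡ just a → Member a v
    branch⇒member {a} {v} eq with member? v
    ... | yes (b , mem) = subst (λ c → Member c v) (just-injective eq) mem
    branch⇒member () | no _

    in-branch : ∀ e a → branch (vertex e a) ≡ just a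
    in-branch e a = member⇒branch (e , refl)

    path : ∀ a e f → PathIn G (λ w → branch w ≡ just a) (vertex e a) (vertex f a)
    path a e f with clique a e f
    ... | inj₁ eq   = subst (PathIn G _ (vertex e a)) eq (here (in-branch e a))
    ... | inj₂ edge = step (in-branch e a) edge (here (in-branch f a))

  pairModel⇒minor : KMinor G k
  pairModel⇒minor = record
    { branch    = branch
    ; nonempty  = λ a → vertex zero a , in-branch zero a
    ; connected = connected
    ; touching  = λ a b a≢b → let (e , f , edge) = touching a b a≢b in
                    vertex e a , vertex f b , in-branch e a , in-branch f b , edge
    }
    where
    connected : ∀ a u v → branch u ≡ just a → branch v ≡ just a →
                PathIn G (λ w → branch w ≡ just a) u v
    connected a u v u∈a v∈a with branch⇒member u∈a | branch⇒member v∈a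
    ... | e , refl | f , refl = path a e f

module _ {m k : ℕ} (vertex : Fin 2 → Fin k → Fin m) where

  disjoint? : Dec (∀ e f a b → vertex e a ≡ vertex f b → a ≡ b)
  disjoint? = all? λ e → all? λ f → all? λ a → all? λ b → (vertex e a ≟ᶠ vertex f b) →-dec (a ≟ᶠ b)

  clique? : Dec (∀ a e f → vertex e a ≡ vertex f a ⊎ CoCycle m (vertex e a) (vertex f a))
  clique? = all? λ a → all? λ e → all? λ f →
    (vertex e a ≟ᶠ vertex f a) ⊎-dec coCycle? m (vertex e a) (vertex f a)

  touching? : Dec (∀ a b → a ≢ b → ∃₂ λ e f → CoCycle m (vertex e a) (vertex f b))
  touching? = all? λ a → all? λ b → ¬? (a ≟ᶠ b) →-dec
    (any? λ e → any? λ f → coCycle? m (vertex e a) (vertex f b))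

fromPairs : ∀ {m k} → Vec (Fin m × Fin m) k → Fin 2 → Fin k → Fin m
fromPairs ps zero    a = proj₁ (lookup ps a)
fromPairs ps (suc _) a = proj₂ (lookup ps a)

decidedPairModel : ∀ {m k} (ps : Vec (Fin m × Fin m) k) →
  {_ : True (disjoint? (fromPairs ps))} {_ : True (clique? (fromPairs ps))}
  {_ : True (touching? (fromPairs ps))} → PairModel (CoCycle m) k
decidedPairModel ps {d} {c} {t} = record
  { vertex   = fromPairs ps
  ; disjoint = toWitness d
  ; clique   = toWitness c
  ; touching = toWitness t
  }

coC₅-model : PairModel (CoCycle 5) 3
coC₅-model = decidedPairModel ((# 0 , # 2) ∷ (# 1 , # 4) ∷ (# 3 , # 3) ∷ [])

coC₆-model : PairModel (CoCycle 6) 4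
coC₆-model = decidedPairModel ((# 0 , # 0) ∷ (# 3 , # 3) ∷ (# 1 , # 4) ∷ (# 2 , # 5) ∷ [])

module OddsAndPairs (m s₁ s₂ : ℕ) (2s₁≤m : 2 * s₁ ≤ m) (4s₂≤1+m : 2 * (2 * s₂) ≤ suc m)
                    (2≤s₂ : 2 ≤ s₂) where

  s₂≢0 : s₂ ≢ 0
  s₂≢0 s₂≡0 = n≮0 (subst (2 ≤_) s₂≡0 2≤s₂)

  gap : 3 + 2 * s₂ ≤ m
  gap = ≤-pred (begin
    4 + 2 * s₂      ≤⟨ +-monoˡ-≤ (2 * s₂) (*-monoʳ-≤ 2 2≤s₂) ⟩
    2 * s₂ + 2 * s₂ ≡⟨ 2*n≡n+n (2 * s₂) ⟨
    2 * (2 * s₂)    ≤⟨ 4s₂≤1+m ⟩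
    suc m           ∎)
    where open ≤-Reasoning

  below-last : ∀ {p} → p ≤ suc (2 * s₂) → p ≢ m ∸ 1
  below-last {p} p≤ p≡ = 1+n≰n (begin
    suc m                 ≤⟨ s≤s (m≤n+m∸n m 1) ⟩
    suc (suc (m ∸ 1))     ≡⟨ cong (λ x → suc (suc x)) (sym p≡) ⟩
    suc (suc p)           ≤⟨ s≤s (s≤s p≤) ⟩
    3 + 2 * s₂            ≤⟨ gap ⟩
    m                     ∎)
    where open ≤-Reasoning

  odd : ℕ → ℕ
  odd a = suc (2 * a)

  shifted : ℕ → ℕ
  shifted j = 2 * (j + s₂)

  firsts-¬adj : ∀ {i j} → i < s₂ → j < s₂ → ¬ CycleAdjℕ m (2 * i) (2 * j)
  firsts-¬adj {i} {j} i<s₂ j<s₂ adj with even-adj⇒wrap m i j adj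
  ... | inj₁ (_ , last) = below-last (m≤n⇒m≤1+n (*-monoʳ-≤ 2 (<⇒≤ j<s₂))) last
  ... | inj₂ (_ , last) = below-last (m≤n⇒m≤1+n (*-monoʳ-≤ 2 (<⇒≤ i<s₂))) last

  pair-¬adj : ∀ j → ¬ CycleAdjℕ m (2 * j) (shifted j)
  pair-¬adj j adj with even-adj⇒wrap m j (j + s₂) adj
  ... | inj₁ (refl , last) = below-last (n≤1+n _) last
  ... | inj₂ (j+s₂≡0 , _)  = s₂≢0 (m+n≡0⇒n≡0 j j+s₂≡0)

  pair-distinct : ∀ j → 2 * j ≢ shifted j
  pair-distinct j eq = <⇒≢ (m<m+n j (n≢0⇒n>0 s₂≢0)) (double-injective eq)

  odd-sees-pair : ∀ a j → ¬ CycleAdjℕ m (odd a) (2 * j) ⊎ ¬ CycleAdjℕ m (odd a) (shifted j)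
  odd-sees-pair a j with cycleAdjℕ? m (odd a) (2 * j)
  ... | no ¬adj = inj₁ ¬adj
  ... | yes adj = inj₂ λ adj′ → both (odd-even-adj m a j adj) (odd-even-adj m a (j + s₂) adj′)
    where
    both : (a ≤ j × j ≤ suc a) ⊎ (j ≡ 0 × odd a ≡ m ∸ 1) →
           (a ≤ j + s₂ × j + s₂ ≤ suc a) ⊎ (j + s₂ ≡ 0 × odd a ≡ m ∸ 1) → ⊥
    both _ (inj₂ (j+s₂≡0 , _)) = s₂≢0 (m+n≡0⇒n≡0 j j+s₂≡0)
    both (inj₁ (a≤j , _)) (inj₁ (_ , j+s₂≤1+a)) =
      <⇒≱ 2≤s₂ (+-cancelˡ-≤ j s₂ 1
        (≤-trans j+s₂≤1+a (≤-trans (s≤s a≤j) (≤-reflexive (+-comm 1 j)))))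
    both (inj₂ (refl , last)) (inj₁ (a≤s₂ , _)) = below-last (s≤s (*-monoʳ-≤ 2 a≤s₂)) last

  Index : Set
  Index = Fin s₁ ⊎ Fin s₂

  position : Fin 2 → Index → ℕ
  position _       (inj₁ a) = odd (toℕ a)
  position zero    (inj₂ j) = 2 * toℕ j
  position (suc _) (inj₂ j) = shifted (toℕ j)

  shifted<m : ∀ {j} → j < s₂ → shifted j < m
  shifted<m {j} j<s₂ = ≤-pred (begin
    suc (suc (shifted j)) ≡⟨ *-suc 2 (j + s₂) ⟨
    2 * suc (j + s₂)      ≤⟨ *-monoʳ-≤ 2 j+s₂<2s₂ ⟩
    2 * (2 * s₂)          ≤⟨ 4s₂≤1+m ⟩
    suc m                 ∎)
    where
    open ≤-Reasoning
    j+s₂<2s₂ : j + s₂ < 2 * s₂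
    j+s₂<2s₂ = subst (j + s₂ <_) (sym (2*n≡n+n s₂)) (+-monoˡ-< s₂ j<s₂)

  position<m : ∀ e p → position e p < m
  position<m _ (inj₁ a) = begin
    suc (odd (toℕ a)) ≡⟨ *-suc 2 (toℕ a) ⟨
    2 * suc (toℕ a)   ≤⟨ *-monoʳ-≤ 2 (toℕ<n a) ⟩
    2 * s₁            ≤⟨ 2s₁≤m ⟩
    m                 ∎
    where open ≤-Reasoning
  position<m zero    (inj₂ j) = ≤-<-trans (*-monoʳ-≤ 2 (m≤m+n (toℕ j) s₂)) (shifted<m (toℕ<n j))
  position<m (suc _) (inj₂ j) = shifted<m (toℕ<n j)

  position-injective : ∀ e f p q → position e p ≡ position f q → p ≡ q
  position-injective _ _ (inj₁ a) (inj₁ b) eq =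
    cong inj₁ (toℕ-injective (double-injective (suc-injective eq)))
  position-injective _ zero    (inj₁ a) (inj₂ j) eq = ⊥-elim (even≢odd (toℕ j) (toℕ a) (sym eq))
  position-injective _ (suc _) (inj₁ a) (inj₂ j) eq =
    ⊥-elim (even≢odd (toℕ j + s₂) (toℕ a) (sym eq))
  position-injective zero    _ (inj₂ j) (inj₁ a) eq = ⊥-elim (even≢odd (toℕ j) (toℕ a) eq)
  position-injective (suc _) _ (inj₂ j) (inj₁ a) eq =
    ⊥-elim (even≢odd (toℕ j + s₂) (toℕ a) eq)
  position-injective zero zero (inj₂ i) (inj₂ j) eq =
    cong inj₂ (toℕ-injective (double-injective eq))
  position-injective (suc _) (suc _) (inj₂ i) (inj₂ j) eq =
    cong inj₂ (toℕ-injective (+-cancelʳ-≡ s₂ (toℕ i) (toℕ j) (double-injective eq)))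
  position-injective zero (suc _) (inj₂ i) (inj₂ j) eq =
    ⊥-elim (<⇒≱ (toℕ<n i) (≤-trans (m≤n+m s₂ (toℕ j)) (≤-reflexive (sym (double-injective eq)))))
  position-injective (suc _) zero (inj₂ i) (inj₂ j) eq =
    ⊥-elim (<⇒≱ (toℕ<n j) (≤-trans (m≤n+m s₂ (toℕ i)) (≤-reflexive (double-injective eq))))

  vertex : Fin 2 → Index → Fin m
  vertex e p = Fin.fromℕ< (position<m e p)

  toℕ-vertex : ∀ e p → toℕ (vertex e p) ≡ position e p
  toℕ-vertex e p = toℕ-fromℕ< (position<m e p)

  vertex≡⇒position≡ : ∀ e f p q → vertex e p ≡ vertex f q → position e p ≡ position f q
  vertex≡⇒position≡ e f p q eq = trans (sym (toℕ-vertex e p)) (trans (cong toℕ eq) (toℕ-vertex f q))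

  vertex-injective : ∀ e f p q → vertex e p ≡ vertex f q → p ≡ q
  vertex-injective e f p q = position-injective e f p q ∘ vertex≡⇒position≡ e f p q

  coadjacent : ∀ e f p q → position e p ≢ position f q →
               ¬ CycleAdjℕ m (position e p) (position f q) → CoCycle m (vertex e p) (vertex f q)
  coadjacent e f p q ≢ ¬adj =
    (λ eq → ≢ (vertex≡⇒position≡ e f p q eq)) ,
    (λ adj → ¬adj (subst₂ (CycleAdjℕ m) (toℕ-vertex e p) (toℕ-vertex f q) adj))

  apart : ∀ p q → ∃₂ λ e f → ¬ CycleAdjℕ m (position e p) (position f q)
  apart (inj₁ a) (inj₁ b) = zero , zero , odd-odd-¬adj m (toℕ a) (toℕ b)
  apart (inj₁ a) (inj₂ j) with odd-sees-pair (toℕ a) (toℕ j)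
  ... | inj₁ ¬adj = zero , zero , ¬adj
  ... | inj₂ ¬adj = zero , suc zero , ¬adj
  apart (inj₂ j) (inj₁ a) with odd-sees-pair (toℕ a) (toℕ j)
  ... | inj₁ ¬adj = zero , zero , λ adj → ¬adj (cycleAdjℕ-sym {m} adj)
  ... | inj₂ ¬adj = suc zero , zero , λ adj → ¬adj (cycleAdjℕ-sym {m} adj)
  apart (inj₂ i) (inj₂ j) = zero , zero , firsts-¬adj (toℕ<n i) (toℕ<n j)

  pair-edge : ∀ j → CoCycle m (vertex zero (inj₂ j)) (vertex (suc zero) (inj₂ j))
  pair-edge j =
    coadjacent zero (suc zero) (inj₂ j) (inj₂ j) (pair-distinct (toℕ j)) (pair-¬adj (toℕ j))

  clique : ∀ p e f → vertex e p ≡ vertex f p ⊎ CoCycle m (vertex e p) (vertex f p)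
  clique (inj₁ a) _       _       = inj₁ refl
  clique (inj₂ j) zero    zero    = inj₁ refl
  clique (inj₂ j) (suc _) (suc _) = inj₁ refl
  clique (inj₂ j) zero    (suc zero) = inj₂ (pair-edge j)
  clique (inj₂ j) (suc zero) zero    = inj₂ (coCycle-sym {m} (pair-edge j))

  touching : ∀ p q → p ≢ q → ∃₂ λ e f → CoCycle m (vertex e p) (vertex f q)
  touching p q p≢q with apart p q
  ... | e , f , ¬adj = e , f , coadjacent e f p q (λ eq → p≢q (position-injective e f p q eq)) ¬adj

  model : PairModel (CoCycle m) (s₁ + s₂)
  model = record
    { vertex   = λ e x → vertex e (Fin.splitAt s₁ x)
    ; disjoint = λ e f x y eq → splitAt-injective s₁ s₂
                   (vertex-injective e f (Fin.splitAt s₁ x) (Fin.splitAt s₁ y) eq)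
    ; clique   = λ x → clique (Fin.splitAt s₁ x)
    ; touching = λ x y x≢y → touching _ _ (λ eq → x≢y (splitAt-injective s₁ s₂ eq))
    }

half+quarter : ∀ m → m / 2 + suc m / 4 ≡ 3 * m / 4
half+quarter 0 = refl
half+quarter 1 = refl
half+quarter 2 = refl
half+quarter 3 = refl
half+quarter (suc (suc (suc (suc m)))) = begin
  (4 + m) / 2 + (4 + suc m) / 4   ≡⟨ cong₂ _+_ (+-distrib-/-∣ˡ m {2} (divides-refl 2))
                                                (+-distrib-/-∣ˡ (suc m) {4} (divides-refl 1)) ⟩
  (2 + m / 2) + (1 + suc m / 4)   ≡⟨ cong (2 +_) (+-suc (m / 2) (suc m / 4)) ⟩
  3 + (m / 2 + suc m / 4)         ≡⟨ cong (3 +_) (half+quarter m) ⟩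
  3 + 3 * m / 4                   ≡⟨ +-distrib-/-∣ˡ (3 * m) {4} (divides-refl 3) ⟨
  (12 + 3 * m) / 4                ≡⟨ cong (_/ 4) (*-distribˡ-+ 3 4 m) ⟨
  3 * (4 + m) / 4                 ∎
  where open ≡-Reasoning

coCycle-minor : ∀ n → KMinor (CoCycle (5 + n)) (3 * (5 + n) / 4)
coCycle-minor 0 = pairModel⇒minor coC₅-model
coCycle-minor 1 = pairModel⇒minor coC₆-model
coCycle-minor (suc (suc n)) =
  subst (KMinor (CoCycle m)) (half+quarter m)
    (pairModel⇒minor (OddsAndPairs.model m (m / 2) (suc m / 4) half-bound quarter-bound 2≤quarter))
  where
  m : ℕ
  m = 7 + n
  half-bound : 2 * (m / 2) ≤ m
  half-bound = subst (_≤ m) (*-comm (m / 2) 2) (m/n*n≤m m 2)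
  quarter-bound : 2 * (2 * (suc m / 4)) ≤ suc m
  quarter-bound = subst (_≤ suc m) (trans (*-comm (suc m / 4) 4) (*-assoc 2 2 (suc m / 4)))
                        (m/n*n≤m (suc m) 4)
  2≤quarter : 2 ≤ suc m / 4
  2≤quarter = /-monoˡ-≤ 4 (m≤m+n 8 n)

next : ∀ {n} → Fin (suc n) → Fin (suc n)
next {n} i with toℕ i ℕ.≟ n
... | yes _   = zero
... | no i≢n  = suc (Fin.lower₁ i (i≢n ∘ sym))

toℕ-next : ∀ {n} (i : Fin (suc n)) →
           (toℕ i ≡ n × toℕ (next i) ≡ 0) ⊎ toℕ (next i) ≡ suc (toℕ i)
toℕ-next {n} i with toℕ i ℕ.≟ n
... | yes i≡n = inj₁ (i≡n , refl)
... | no i≢n  = inj₂ (cong suc (toℕ-lower₁ i (i≢n ∘ sym)))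

next-adj : ∀ {n} (i : Fin (suc n)) → CycleAdj (suc n) i (next i)
next-adj i with toℕ-next i
... | inj₁ (i≡n , next≡0) = inj₂ (inj₂ (inj₂ (next≡0 , i≡n)))
... | inj₂ next≡1+i       = inj₁ next≡1+i

next-injective : ∀ {n} {i j : Fin (suc n)} → next i ≡ next j → i ≡ j
next-injective {i = i} {j} eq with toℕ-next i | toℕ-next j
... | inj₁ (i≡n , _) | inj₁ (j≡n , _) = toℕ-injective (trans i≡n (sym j≡n))
... | inj₂ i′ | inj₂ j′ = toℕ-injective (suc-injective (trans (sym i′) (trans (cong toℕ eq) j′)))
... | inj₁ (_ , i′) | inj₂ j′ = ⊥-elim (0≢1+n (trans (sym i′) (trans (cong toℕ eq) j′)))
... | inj₂ i′ | inj₁ (_ , j′) = ⊥-elim (0≢1+n (trans (sym j′) (trans (cong toℕ (sym eq)) i′)))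

IsSingletonBranch : ∀ {m k} → (Fin m → Maybe (Fin k)) → Fin k → Fin m → Set
IsSingletonBranch β a u = β u ≡ just a × (∀ w → β w ≡ just a → w ≡ u)

module TokenCount {n k : ℕ} (2≤m : 2 ≤ suc n) (β : Fin (suc n) → Maybe (Fin k))
  (nonempty : ∀ a → ∃ λ v → β v ≡ just a)
  (singletons-apart : ∀ {a b u v} → a ≢ b → IsSingletonBranch β a u → IsSingletonBranch β b v →
                      ¬ CycleAdj (suc n) u v)
  where

  rep : Fin k → Fin (suc n)
  rep a = proj₁ (nonempty a)

  rep∈ : ∀ a → β (rep a) ≡ just a
  rep∈ a = proj₂ (nonempty a)

  data Shape (a : Fin k) : Set where
    large  : ∀ s → β s ≡ just a → s ≢ rep a → Shape a
    single : (∀ w → β w ≡ just a → w ≡ rep a) → Shape a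

  shape : ∀ a → Shape a
  shape a with any? (λ v → ≡-decᵐ _≟ᶠ_ (β v) (just a) ×-dec ¬? (v ≟ᶠ rep a))
  ... | yes (s , s∈a , s≢rep) = large s s∈a s≢rep
  ... | no ¬large = single only
    where
    only : ∀ w → β w ≡ just a → w ≡ rep a
    only w w∈a with w ≟ᶠ rep a
    ... | yes w≡rep = w≡rep
    ... | no w≢rep  = ⊥-elim (¬large (w , w∈a , w≢rep))

  next≢ : ∀ (i : Fin (suc n)) → next i ≢ i
  next≢ i eq = cycleAdjℕ-irrefl 2≤m (subst (CycleAdj (suc n) i) eq (next-adj i))

  ends : ∀ a → Shape a → Fin 2 → Fin (suc n)
  ends a _              zero    = rep a
  ends a (large s _ _)  (suc _) = s
  ends a (single _)     (suc _) = next (rep a)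

  ends-injective : ∀ a sh {i j} → ends a sh i ≡ ends a sh j → i ≡ j
  ends-injective a sh {zero} {zero} _ = refl
  ends-injective a sh {suc zero} {suc zero} _ = refl
  ends-injective a (large s _ s≢rep) {zero} {suc zero} eq = ⊥-elim (s≢rep (sym eq))
  ends-injective a (large s _ s≢rep) {suc zero} {zero} eq = ⊥-elim (s≢rep eq)
  ends-injective a (single _) {zero} {suc zero} eq = ⊥-elim (next≢ (rep a) (sym eq))
  ends-injective a (single _) {suc zero} {zero} eq = ⊥-elim (next≢ (rep a) eq)

  marker : Fin 3
  marker = fromℕ 2

  inject₁≢marker : ∀ (j : Fin 2) → inject₁ j ≢ marker
  inject₁≢marker j eq = fromℕ≢inject₁ (sym eq)

  token : ∀ a → Shape a → Fin 2 → Fin 2 → Fin (suc n) × Fin 3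
  token a sh@(large _ _ _) i j       = ends a sh i , inject₁ j
  token a (single _)       i zero    = rep a , inject₁ i
  token a sh@(single _)    i (suc _) = ends a sh i , marker

  token-injective : ∀ a sh {i j i′ j′} → token a sh i j ≡ token a sh i′ j′ → (i , j) ≡ (i′ , j′)
  token-injective a sh@(large _ _ _) eq =
    let (e₁ , e₂) = ,-injective eq in cong₂ _,_ (ends-injective a sh e₁) (inject₁-injective e₂)
  token-injective a (single _) {j = zero} {j′ = zero} eq =
    cong (_, zero) (inject₁-injective (proj₂ (,-injective eq)))
  token-injective a (single _) {i} {j = zero} {j′ = suc _} eq =
    ⊥-elim (inject₁≢marker i (proj₂ (,-injective eq)))
  token-injective a (single _) {j = suc _} {i′ = i′} {j′ = zero} eq =
    ⊥-elim (inject₁≢marker i′ (sym (proj₂ (,-injective eq))))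
  token-injective a sh@(single _) {j = suc zero} {j′ = suc zero} eq =
    cong (_, suc zero) (ends-injective a sh (proj₁ (,-injective eq)))

  data Owner (a : Fin k) : Fin (suc n) × Fin 3 → Set where
    member : ∀ {v s} → s ≢ marker → β v ≡ just a → Owner a (v , s)
    flag   : ∀ {v} → IsSingletonBranch β a (rep a) → v ≡ rep a ⊎ v ≡ next (rep a) →
             Owner a (v , marker)

  owner : ∀ a sh i j → Owner a (token a sh i j)
  owner a (large _ _ _)   zero    j = member (inject₁≢marker j) (rep∈ a)
  owner a (large _ s∈a _) (suc _) j = member (inject₁≢marker j) s∈a
  owner a (single _)    i       zero    = member (inject₁≢marker i) (rep∈ a)
  owner a (single only) zero    (suc _) = flag (rep∈ a , only) (inj₁ refl)
  owner a (single only) (suc _) (suc _) = flag (rep∈ a , only) (inj₂ refl)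

  same-branch : ∀ {a b v} → β v ≡ just a → β v ≡ just b → a ≡ b
  same-branch v∈a v∈b = just-injective (trans (sym v∈a) v∈b)

  same-rep : ∀ {a b} → rep a ≡ rep b → a ≡ b
  same-rep {a} {b} eq = same-branch (rep∈ a) (subst (λ v → β v ≡ just b) (sym eq) (rep∈ b))

  flagged-neighbours : ∀ {a b} → IsSingletonBranch β a (rep a) → IsSingletonBranch β b (rep b) →
                       rep a ≡ next (rep b) → a ≡ b
  flagged-neighbours {a} {b} sa sb eq with a ≟ᶠ b
  ... | yes a≡b = a≡b
  ... | no a≢b  = ⊥-elim (singletons-apart (a≢b ∘ sym) sb sa
                    (subst (CycleAdj (suc n) (rep b)) (sym eq) (next-adj (rep b))))

  owner-unique : ∀ {a b x} → Owner a x → Owner b x → a ≡ b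
  owner-unique (member _ v∈a) (member _ v∈b) = same-branch v∈a v∈b
  owner-unique (member s≢ _) (flag _ _) = ⊥-elim (s≢ refl)
  owner-unique (flag _ _) (member s≢ _) = ⊥-elim (s≢ refl)
  owner-unique (flag _ (inj₁ refl)) (flag _ (inj₁ eq)) = same-rep eq
  owner-unique (flag _ (inj₂ refl)) (flag _ (inj₂ eq)) = same-rep (next-injective eq)
  owner-unique (flag sa (inj₁ refl)) (flag sb (inj₂ eq)) = flagged-neighbours sa sb eq
  owner-unique (flag sa (inj₂ refl)) (flag sb (inj₁ eq)) = sym (flagged-neighbours sb sa (sym eq))

  tokens : Fin k × Fin 4 → Fin (suc n) × Fin 3
  tokens (a , t) = uncurry (token a (shape a)) (Fin.remQuot 2 t)

  tokens-injective : ∀ {x y} → tokens x ≡ tokens y → x ≡ y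
  tokens-injective {a , t} {b , u} eq
    with owner-unique (subst (Owner a) eq (uncurry (owner a (shape a)) (Fin.remQuot 2 t)))
                      (uncurry (owner b (shape b)) (Fin.remQuot 2 u))
  ... | refl = cong (a ,_) (remQuot-injective {2} 2 (token-injective a (shape a) eq))

  token-bound : k * 4 ≤ suc n * 3
  token-bound = ×-injective⇒≤ tokens tokens-injective

module CoWheelMinor {m k : ℕ} (M : KMinor (CoWheel (suc m)) k) where
  open KMinor M

  hub-unused : ∀ {a b} → a ≢ b → branch zero ≢ just a
  hub-unused {a} {b} a≢b hub∈a with touching a b a≢b
  ... | u , v , u∈a , _ , edge with path-from-hub (connected a zero u hub∈a u∈a)
  ...   | refl = hub-isolated v edge

  rim-branch : Fin m → Maybe (Fin k)
  rim-branch v = branch (suc v)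

  rim-nonempty : (∀ a → ∃ λ b → a ≢ b) → ∀ a → ∃ λ v → rim-branch v ≡ just a
  rim-nonempty other a with nonempty a
  ... | zero  , hub∈a = ⊥-elim (hub-unused (proj₂ (other a)) hub∈a)
  ... | suc v , v∈a   = v , v∈a

  rim-singletons-apart : ∀ {a b u v} → a ≢ b → IsSingletonBranch rim-branch a u →
                         IsSingletonBranch rim-branch b v → ¬ CycleAdj m u v
  rim-singletons-apart {a} {b} a≢b (_ , only-u) (_ , only-v) adj with touching a b a≢b
  ... | zero  , _     , hub∈a , _     , _ = hub-unused a≢b hub∈a
  ... | suc _ , zero  , _     , hub∈b , _ = hub-unused (a≢b ∘ sym) hub∈b
  ... | suc x , suc y , x∈a   , y∈b   , (_ , ¬adj) with only-u x x∈a | only-v y y∈b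
  ...   | refl | refl = ¬adj adj

coWheel-bound : ∀ {m k} → 2 ≤ m → KMinor (CoWheel (suc m)) k → k * 4 ≤ m * 3
coWheel-bound {k = zero}  _   _ = z≤n
coWheel-bound {k = suc zero} 2≤m _ = ≤-trans (s≤s (s≤s (s≤s (s≤s z≤n)))) (*-monoˡ-≤ 3 2≤m)
coWheel-bound {suc n} {suc (suc k)} 2≤m M =
  TokenCount.token-bound 2≤m rim-branch (rim-nonempty other) rim-singletons-apart
  where
  open CoWheelMinor M
  other : ∀ (a : Fin (suc (suc k))) → ∃ λ b → a ≢ b
  other zero    = suc zero , λ ()
  other (suc _) = zero , λ ()

corollary6 : (n : ℕ) → 6 ≤ n →
    IsHadwigerNumber (Complement (Wheel n)) ((3 * (n ∸ 1)) / 4)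
corollary6 n 6≤n with m≤n⇒∃[o]m+o≡n 6≤n
... | o , refl = coWheel-minor (coCycle-minor o) , maximal
  where
  maximal : ∀ k → KMinor (CoWheel (6 + o)) k → k ≤ 3 * (5 + o) / 4
  maximal k M = m*n≤o⇒m≤o/n k 4 (3 * (5 + o))
    (subst (k * 4 ≤_) (*-comm (5 + o) 3) (coWheel-bound (s≤s (s≤s z≤n)) M))
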